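{- Let $\Gamma$ be a distance-regular graph of diameter $d$ with intersection numbers $p_{i,j}^k$, and let $m\ge 2$ be an integer. Let $G$ be an automorphism group of $\Gamma$ acting on the vertex set with $n$ orbits, all of the same length, and for $i=1,\dots,d$ let $M_i$ be the $n\times n$ quotient matrix of the distance-$i$ matrix $A_i$ of $\Gamma$ with respect to the orbit partition of $G$. If there exists $i\in\{1,2,\dots,d\}$ such that $m$ divides $p_{i,i}^k$ for all $k\in\{0,1,\dots,d\}$, then the rows of $M_i$ (with entries reduced modulo $m$) span a self-orthogonal code of length $n$ over the ring $\mathbb{Z}_m$.
   Context: For a connected graph $\Gamma$ of diameter $d$, the distance-$i$ matrix $A_i$ has $(u,v)$-entry $1$ if the distance between $u,v$ is $i$ and $0$ otherwise. $\Gamma$ is distance-regular if for all $0\le i,j,k\le d$ there is a constant $p_{i,j}^k$ such that any vertices $v,w$ at distance $k$ satisfy $|\{z: \delta(v,z)=i,\ \delta(z,w)=j\}|=p_{i,j}^k$. For a partition of the vertex set into cells $C_0,\dots,C_{n-1}$ equitable for the graph with adjacency matrix $A_i$ (every vertex of $C_a$ has the same number $b_{a,b}$ of $A_i$-neighbours in $C_b$), the quotient matrix is $(b_{a,b})$. A code over $\mathbb{Z}_m$ of length $n$ is a submodule $C$ of $\mathbb{Z}_m^n$; it is self-orthogonal if $\sum_l x_ly_l=0$ in $\mathbb{Z}_m$ for all $x,y\in C$. -}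

module Defs where

open import Data.Nat using (ℕ; zero; suc; _+_; _*_; _≤_; _%_; NonZero)
open import Data.Nat.Divisibility using (_∣_)
open import Data.Bool using (Bool; true; false; _∧_; _∨_; not; if_then_else_)
open import Data.Fin using (Fin; toℕ) renaming (zero to fz; suc to fs)
open import Data.Fin.Properties using () renaming (_≟_ to _≟F_)
open import Data.Product using (Σ; ∃; _×_; _,_)
open import Relation.Binary.PropositionalEquality using (_≡_)
open import Relation.Nullary.Decidable using (⌊_⌋)

∑ : {n : ℕ} → (Fin n → ℕ) → ℕ
∑ {zero}  f = 0
∑ {suc n} f = f fz + ∑ (λ i → f (fs i))

count : {n : ℕ} → (Fin n → Bool) → ℕ
count p = ∑ (λ z → if p z then 1 else 0)

any : {n : ℕ} → (Fin n → Bool) → Bool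
any {zero}  p = false
any {suc n} p = p fz ∨ any (λ i → p (fs i))

eqF : {n : ℕ} → Fin n → Fin n → Bool
eqF a b = ⌊ a ≟F b ⌋

record Graph (N : ℕ) : Set where
  field
    adj   : Fin N → Fin N → Bool
    sym   : ∀ u v → adj u v ≡ adj v u
    irrefl : ∀ u → adj u u ≡ false

module _ {N : ℕ} (Γ : Graph N) where
  open Graph Γ

  -- reach k u v = true  iff  δ(u,v) ≤ k  (there is a walk of length ≤ k)
  reach : ℕ → Fin N → Fin N → Bool
  reach zero    u v = eqF u v
  reach (suc k) u v = reach k u v ∨ any (λ w → reach k u w ∧ adj w v)

  -- dist i u v = true  iff  δ(u,v) = i ; this is the (u,v)-entry of A_i
  dist : ℕ → Fin N → Fin N → Bool
  dist zero    u v = eqF u v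
  dist (suc i) u v = reach (suc i) u v ∧ not (reach i u v)

  ConnectedDiameter : ℕ → Set
  ConnectedDiameter d = (∀ u v → reach d u v ≡ true) × (∃ λ u → ∃ λ v → dist d u v ≡ true)

  DistanceRegular : ℕ → (ℕ → ℕ → ℕ → ℕ) → Set
  DistanceRegular d p =
    ConnectedDiameter d ×
    (∀ i j k → i ≤ d → j ≤ d → k ≤ d → ∀ v w → dist k v w ≡ true →
       count (λ z → dist i v z ∧ dist j z w) ≡ p i j k)

  record AutGroup : Set₁ where
    field
      Idx      : Set
      act      : Idx → Fin N → Fin N
      preserve : ∀ g u v → adj (act g u) (act g v) ≡ adj u v
      ident    : ∃ λ e → ∀ x → act e x ≡ x
      comp     : ∀ g h → ∃ λ k → ∀ x → act k x ≡ act g (act h x)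
      inv      : ∀ g → ∃ λ h → ∀ x → act h (act g x) ≡ x × act g (act h x) ≡ x

  IsOrbitPartition : AutGroup → (n : ℕ) → (Fin N → Fin n) → Set
  IsOrbitPartition G n orb =
    (∀ a → ∃ λ u → orb u ≡ a) ×
    (∀ u v → orb u ≡ orb v → ∃ λ g → AutGroup.act G g u ≡ v) ×
    (∀ u v g → AutGroup.act G g u ≡ v → orb u ≡ orb v)

  EqualOrbitLengths : (n : ℕ) → (Fin N → Fin n) → Set
  EqualOrbitLengths n orb = ∀ a b → count (λ z → eqF (orb z) a) ≡ count (λ z → eqF (orb z) b)

  IsQuotientMatrix : ℕ → (n : ℕ) → (Fin N → Fin n) → (Fin n → Fin n → ℕ) → Set
  IsQuotientMatrix i n orb Q =
    ∀ u b → Q (orb u) b ≡ count (λ z → dist i u z ∧ eqF (orb z) b)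

-- Codes over ℤ_m of length n: vectors Fin n → Fin m (entries are residues).
-- x lies in the code spanned (over ℤ_m) by the rows of Q reduced mod m.
InRowSpan : (m : ℕ) .{{_ : NonZero m}} {n : ℕ} → (Fin n → Fin n → ℕ) → (Fin n → Fin m) → Set
InRowSpan m {n} Q x = ∃ λ (c : Fin n → ℕ) → ∀ l → toℕ (x l) ≡ (∑ (λ r → c r * Q r l)) % m

SelfOrthogonal : (m : ℕ) .{{_ : NonZero m}} {n : ℕ} → ((Fin n → Fin m) → Set) → Set
SelfOrthogonal m {n} C = ∀ x y → C x → C y → (∑ (λ l → toℕ (x l) * toℕ (y l))) % m ≡ 0

module Submission where

-- Let A be the distance-i matrix of Γ and S the characteristic matrix of the orbit partition, so
-- that M is a quotient matrix exactly when S M = A S.  Counting the pairs at distance i between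
-- two cells gives |C_a| M_ab = (Sᵀ A S)_ab, which is symmetric in a and b; since all cells have
-- the same size, M is symmetric.  Quotient matrices multiply, so M² is a quotient matrix of A²,
-- whose (u, w)-entry is the intersection number p_{ii}^{δ(u,w)} and hence divisible by m.
-- Thus M Mᵀ = M² vanishes mod m, and the inner product of two combinations of rows of M is a
-- combination of entries of M Mᵀ.

open import Defs
open import Data.Nat using (ℕ; zero; suc; _+_; _*_; _%_; _≤_; z≤n; NonZero; >-nonZero)
open import Data.Nat.Properties
  using (+-*-semiring; *-comm; *-assoc; *-identityˡ; +-identityʳ; *-cancelˡ-≡; m≤m+n; m≤n+m; ≤-trans; m≤n⇒m≤1+n; ≤-refl)
open import Data.Nat.Divisibility using (_∣_; _∣0; ∣m∣n⇒∣m+n; ∣m⇒∣m*n; ∣n⇒∣m*n; n∣m⇒m%n≡0)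
open import Data.Nat.DivMod using (%-distribˡ-+; %-distribˡ-*)
open import Data.Bool using (Bool; true; false; T; not; _∧_; if_then_else_)
open import Data.Bool.Properties using (T-∧; T-∨; T-≡; T?; ⇔→≡)
open import Data.Fin using (Fin; toℕ) renaming (zero to fz; suc to fs)
open import Data.Fin.Properties using () renaming (_≟_ to _≟F_)
open import Data.Product using (∃; _×_; _,_)
open import Data.Sum using (inj₁; inj₂)
open import Data.Unit using (tt)
open import Function using (_∘_; Equivalence; mk⇔)
open import Relation.Nullary using (¬_; yes; no)
open import Relation.Nullary.Decidable using (toWitness; fromWitness)
open import Relation.Binary.PropositionalEquality
open import Algebra.Properties.Semiring.Sum +-*-semiring
  using (sum; sum-cong-≗; ∑-comm; *-distribˡ-sum; *-distribʳ-sum; sum-replicate-zero)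
open Equivalence using (to; from)
open ≡-Reasoning

∑≡sum : ∀ {n} (f : Fin n → ℕ) → ∑ f ≡ sum f
∑≡sum {zero}  f = refl
∑≡sum {suc n} f = cong (f fz +_) (∑≡sum (f ∘ fs))

∣-sum : ∀ {m n} (f : Fin n → ℕ) → (∀ i → m ∣ f i) → m ∣ sum f
∣-sum {m} {zero}  f h = m ∣0
∣-sum {m} {suc n} f h = ∣m∣n⇒∣m+n (h fz) (∣-sum (f ∘ fs) (h ∘ fs))

sum-cong-% : ∀ m .{{_ : NonZero m}} {n} (f g : Fin n → ℕ) →
             (∀ i → f i % m ≡ g i % m) → sum f % m ≡ sum g % m
sum-cong-% m {zero}  f g h = refl
sum-cong-% m {suc n} f g h = begin
  (f fz + sum (f ∘ fs)) % m              ≡⟨ %-distribˡ-+ (f fz) _ m ⟩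
  (f fz % m + sum (f ∘ fs) % m) % m      ≡⟨ cong₂ (λ a b → (a + b) % m) (h fz) (sum-cong-% m (f ∘ fs) (g ∘ fs) (h ∘ fs)) ⟩
  (g fz % m + sum (g ∘ fs) % m) % m      ≡⟨ %-distribˡ-+ (g fz) _ m ⟨
  (g fz + sum (g ∘ fs)) % m              ∎

≤-sum : ∀ {n} (f : Fin n → ℕ) (i : Fin n) → f i ≤ sum f
≤-sum f fz     = m≤m+n (f fz) (sum (f ∘ fs))
≤-sum f (fs i) = ≤-trans (≤-sum (f ∘ fs) i) (m≤n+m (sum (f ∘ fs)) (f fz))

T-ext : ∀ {a b} → (T a → T b) → (T b → T a) → a ≡ b
T-ext f g = ⇔→≡ (mk⇔ (to T-≡ ∘ f ∘ from T-≡) (to T-≡ ∘ g ∘ from T-≡))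

T-not : ∀ {b} → ¬ T b → T (not b)
T-not {false} _  = tt
T-not {true}  ¬t = ¬t tt

any-intro : ∀ {n} (p : Fin n → Bool) w → T (p w) → T (any p)
any-intro p fz     t = from T-∨ (inj₁ t)
any-intro p (fs w) t = from (T-∨ {p fz}) (inj₂ (any-intro (p ∘ fs) w t))

any-elim : ∀ {n} (p : Fin n → Bool) → T (any p) → ∃ λ w → T (p w)
any-elim {suc n} p t with to (T-∨ {p fz}) t
... | inj₁ t₀ = fz , t₀
... | inj₂ t′ with any-elim (p ∘ fs) t′
...   | w , tw = fs w , tw

𝟙 : Bool → ℕ
𝟙 b = if b then 1 else 0

𝟙-T : ∀ {b} → T b → 𝟙 b ≡ 1
𝟙-T {true} _ = refl

𝟙-∧ : ∀ a b → 𝟙 (a ∧ b) ≡ 𝟙 a * 𝟙 b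
𝟙-∧ true  b = sym (*-identityˡ (𝟙 b))
𝟙-∧ false b = refl

count-∧ : ∀ {n} (p q : Fin n → Bool) → count (λ z → p z ∧ q z) ≡ sum (λ z → 𝟙 (p z) * 𝟙 (q z))
count-∧ p q = trans (∑≡sum (λ z → 𝟙 (p z ∧ q z))) (sum-cong-≗ (λ z → 𝟙-∧ (p z) (q z)))

𝟙-eqF-subst : ∀ {n} (a b : Fin n) (f : Fin n → ℕ) → 𝟙 (eqF a b) * f b ≡ 𝟙 (eqF a b) * f a
𝟙-eqF-subst a b f with a ≟F b
... | yes refl = refl
... | no _     = refl

eqF-fs : ∀ {n} (a b : Fin n) → eqF (fs a) (fs b) ≡ eqF a b
eqF-fs a b with a ≟F b
... | yes _ = refl
... | no _  = refl

sum-𝟙-eqF : ∀ {n} (a : Fin n) (f : Fin n → ℕ) → sum (λ b → 𝟙 (eqF a b) * f b) ≡ f a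
sum-𝟙-eqF {suc n} fz     f = trans (cong₂ _+_ (*-identityˡ (f fz)) (sum-replicate-zero n)) (+-identityʳ (f fz))
sum-𝟙-eqF {suc n} (fs a) f = trans (sum-cong-≗ (λ b → cong (λ e → 𝟙 e * f (fs b)) (eqF-fs a b))) (sum-𝟙-eqF a (f ∘ fs))

Matrix : ℕ → ℕ → Set
Matrix r c = Fin r → Fin c → ℕ

module _ {r c : ℕ} where

  infix 10 _ᵀ
  infix 4 _≐_ _∣ᴹ_

  _ᵀ : Matrix r c → Matrix c r
  (A ᵀ) i j = A j i

  _≐_ : Matrix r c → Matrix r c → Set
  A ≐ B = ∀ i j → A i j ≡ B i j

  _∣ᴹ_ : ℕ → Matrix r c → Set
  m ∣ᴹ A = ∀ i j → m ∣ A i j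

infixl 7 _·_

_·_ : ∀ {r s c} → Matrix r s → Matrix s c → Matrix r c
(A · B) i j = sum (λ k → A i k * B k j)

module _ {r s c : ℕ} where

  ·-congˡ : {A A′ : Matrix r s} (B : Matrix s c) → A ≐ A′ → A · B ≐ A′ · B
  ·-congˡ B eq i j = sum-cong-≗ (λ k → cong (_* B k j) (eq i k))

  ·-congʳ : (A : Matrix r s) {B B′ : Matrix s c} → B ≐ B′ → A · B ≐ A · B′
  ·-congʳ A eq i j = sum-cong-≗ (λ k → cong (A i k *_) (eq k j))

  ·-ᵀ : (A : Matrix r s) (B : Matrix s c) → (A · B) ᵀ ≐ B ᵀ · A ᵀ
  ·-ᵀ A B i j = sum-cong-≗ (λ k → *-comm (A j k) (B k i))

  ∣ᴹ-·ˡ : ∀ {m} {A : Matrix r s} (B : Matrix s c) → m ∣ᴹ A → m ∣ᴹ A · B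
  ∣ᴹ-·ˡ B m∣A i j = ∣-sum _ (λ k → ∣m⇒∣m*n (B k j) (m∣A i k))

  ∣ᴹ-·ʳ : ∀ {m} (A : Matrix r s) {B : Matrix s c} → m ∣ᴹ B → m ∣ᴹ A · B
  ∣ᴹ-·ʳ A m∣B i j = ∣-sum _ (λ k → ∣n⇒∣m*n (A i k) (m∣B k j))

·-assoc : ∀ {r s t c} (A : Matrix r s) (B : Matrix s t) (C : Matrix t c) → (A · B) · C ≐ A · (B · C)
·-assoc A B C i j = begin
  sum (λ l → sum (λ k → A i k * B k l) * C l j)    ≡⟨ sum-cong-≗ (λ l → *-distribʳ-sum (C l j) (λ k → A i k * B k l)) ⟩
  sum (λ l → sum (λ k → A i k * B k l * C l j))    ≡⟨ ∑-comm (λ l k → A i k * B k l * C l j) ⟩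
  sum (λ k → sum (λ l → A i k * B k l * C l j))    ≡⟨ sum-cong-≗ (λ k → sum-cong-≗ (λ l → *-assoc (A i k) (B k l) (C l j))) ⟩
  sum (λ k → sum (λ l → A i k * (B k l * C l j)))  ≡⟨ sum-cong-≗ (λ k → *-distribˡ-sum (A i k) (λ l → B k l * C l j)) ⟨
  sum (λ k → A i k * sum (λ l → B k l * C l j))    ∎

congruent-symmetric : ∀ {r c} (P : Matrix r c) (A : Matrix r r) → A ᵀ ≐ A → (P ᵀ · (A · P)) ᵀ ≐ P ᵀ · (A · P)
congruent-symmetric P A A-sym i j = begin
  ((P ᵀ · (A · P)) ᵀ) i j    ≡⟨ ·-ᵀ (P ᵀ) (A · P) i j ⟩
  ((A · P) ᵀ · P) i j        ≡⟨ ·-congˡ P (·-ᵀ A P) i j ⟩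
  ((P ᵀ · A ᵀ) · P) i j      ≡⟨ ·-assoc (P ᵀ) (A ᵀ) P i j ⟩
  (P ᵀ · (A ᵀ · P)) i j      ≡⟨ ·-congʳ (P ᵀ) (·-congˡ P A-sym) i j ⟩
  (P ᵀ · (A · P)) i j        ∎

selfOrthogonal-rowSpan : ∀ m .{{_ : NonZero m}} {n} (M : Matrix n n) →
                         m ∣ᴹ M · M ᵀ → SelfOrthogonal m (InRowSpan m M)
selfOrthogonal-rowSpan m {n} M m∣MMᵀ x y (c , x≡cM) (e , y≡eM) = begin
  ∑ (λ l → toℕ (x l) * toℕ (y l)) % m    ≡⟨ cong (_% m) (∑≡sum (λ l → toℕ (x l) * toℕ (y l))) ⟩
  sum (λ l → toℕ (x l) * toℕ (y l)) % m  ≡⟨ sum-cong-% m _ _ reduce ⟩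
  (X · Y ᵀ) fz fz % m                    ≡⟨ n∣m⇒m%n≡0 ((X · Y ᵀ) fz fz) m m∣XYᵀ ⟩
  0                                      ∎
  where
  C E X Y : Matrix 1 n
  C _ = c
  E _ = e
  X = C · M
  Y = E · M

  residue : ∀ (z : Fin m) (d : Fin n → ℕ) l → toℕ z ≡ ∑ (λ r → d r * M r l) % m →
            toℕ z ≡ ((λ (_ : Fin 1) → d) · M) fz l % m
  residue z d l eq = trans eq (cong (_% m) (∑≡sum (λ r → d r * M r l)))

  reduce : ∀ l → toℕ (x l) * toℕ (y l) % m ≡ X fz l * Y fz l % m
  reduce l = begin
    toℕ (x l) * toℕ (y l) % m                ≡⟨ cong₂ (λ a b → a * b % m) (residue (x l) c l (x≡cM l)) (residue (y l) e l (y≡eM l)) ⟩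
    (X fz l % m) * (Y fz l % m) % m          ≡⟨ %-distribˡ-* (X fz l) (Y fz l) m ⟨
    X fz l * Y fz l % m                      ∎

  XYᵀ-factor : X · Y ᵀ ≐ C · ((M · M ᵀ) · E ᵀ)
  XYᵀ-factor i j = begin
    (X · Y ᵀ) i j                   ≡⟨ ·-congʳ X (·-ᵀ E M) i j ⟩
    (X · (M ᵀ · E ᵀ)) i j           ≡⟨ ·-assoc C M (M ᵀ · E ᵀ) i j ⟩
    (C · (M · (M ᵀ · E ᵀ))) i j     ≡⟨ ·-congʳ C (·-assoc M (M ᵀ) (E ᵀ)) i j ⟨
    (C · ((M · M ᵀ) · E ᵀ)) i j     ∎

  m∣XYᵀ : m ∣ (X · Y ᵀ) fz fz
  m∣XYᵀ = subst (m ∣_) (sym (XYᵀ-factor fz fz)) (∣ᴹ-·ʳ C (∣ᴹ-·ˡ (E ᵀ) m∣MMᵀ) fz fz)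

module Quotient {N n : ℕ} (χ : Fin N → Fin n) where

  characteristic : Matrix N n
  characteristic z b = 𝟙 (eqF (χ z) b)

  cellSize : Fin n → ℕ
  cellSize a = sum (λ u → characteristic u a)

  IsQuotientOf : Matrix N N → Matrix n n → Set
  IsQuotientOf A Q = (λ u → Q (χ u)) ≐ A · characteristic

  characteristic-· : ∀ {c} (R : Matrix n c) → characteristic · R ≐ (λ z → R (χ z))
  characteristic-· R z b = sum-𝟙-eqF (χ z) (λ l → R l b)

  quotient-· : ∀ {A B Q R} → IsQuotientOf A Q → IsQuotientOf B R → IsQuotientOf (A · B) (Q · R)
  quotient-· {A} {B} {Q} {R} qA qB u b = begin
    ((λ u → Q (χ u)) · R) u b         ≡⟨ ·-congˡ R qA u b ⟩
    ((A · S) · R) u b                 ≡⟨ ·-assoc A S R u b ⟩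
    (A · (S · R)) u b                 ≡⟨ ·-congʳ A (characteristic-· R) u b ⟩
    (A · (λ z → R (χ z))) u b         ≡⟨ ·-congʳ A qB u b ⟩
    (A · (B · S)) u b                 ≡⟨ ·-assoc A B S u b ⟨
    ((A · B) · S) u b                 ∎
    where S = characteristic

  AllCellsInhabited : Set
  AllCellsInhabited = ∀ a → ∃ λ u → χ u ≡ a

  cellSize-nonZero : ∀ {u a} → χ u ≡ a → NonZero (cellSize a)
  cellSize-nonZero {u} {a} χu≡a =
    >-nonZero (subst (_≤ cellSize a) (𝟙-T (fromWitness χu≡a)) (≤-sum (λ v → characteristic v a) u))

  cellSize-*-quotient : ∀ {A Q} → IsQuotientOf A Q → ∀ a b → cellSize a * Q a b ≡ (characteristic ᵀ · (A · characteristic)) a b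
  cellSize-*-quotient {A} {Q} qA a b = begin
    cellSize a * Q a b                    ≡⟨ *-distribʳ-sum (Q a b) (λ u → S u a) ⟩
    sum (λ u → S u a * Q a b)             ≡⟨ sum-cong-≗ (λ u → 𝟙-eqF-subst (χ u) a (λ t → Q t b)) ⟩
    sum (λ u → S u a * Q (χ u) b)         ≡⟨ sum-cong-≗ (λ u → cong (S u a *_) (qA u b)) ⟩
    sum (λ u → S u a * (A · S) u b)       ∎
    where S = characteristic

  quotient-symmetric : ∀ {A Q} → AllCellsInhabited → (∀ a b → cellSize a ≡ cellSize b) →
                       A ᵀ ≐ A → IsQuotientOf A Q → Q ᵀ ≐ Q
  quotient-symmetric {A} {Q} inhabited equalSizes A-sym qA a b with inhabited a
  ... | u , χu≡a = *-cancelˡ-≡ (Q b a) (Q a b) (cellSize a) {{cellSize-nonZero χu≡a}} (begin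
    cellSize a * Q b a          ≡⟨ cong (_* Q b a) (equalSizes a b) ⟩
    cellSize b * Q b a          ≡⟨ cellSize-*-quotient {A} qA b a ⟩
    (S ᵀ · (A · S)) b a         ≡⟨ congruent-symmetric S A A-sym a b ⟩
    (S ᵀ · (A · S)) a b         ≡⟨ cellSize-*-quotient {A} qA a b ⟨
    cellSize a * Q a b          ∎)
    where S = characteristic

  quotient-∣ᴹ : ∀ {m A Q} → AllCellsInhabited → IsQuotientOf A Q → m ∣ᴹ A → m ∣ᴹ Q
  quotient-∣ᴹ {m} inhabited qA m∣A a b with inhabited a
  ... | u , refl = subst (m ∣_) (sym (qA u b)) (∣ᴹ-·ˡ characteristic m∣A u b)

module Distances {N : ℕ} (Γ : Graph N) where
  open Graph Γ using (adj) renaming (sym to adj-sym)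

  reach-suc : ∀ k {u v} → T (reach Γ k u v) → T (reach Γ (suc k) u v)
  reach-suc k t = from T-∨ (inj₁ t)

  reach-step : ∀ k {u w v} → T (reach Γ k u w) → T (adj w v) → T (reach Γ (suc k) u v)
  reach-step k {u} {w} {v} r a = from (T-∨ {reach Γ k u v}) (inj₂ (any-intro _ w (from T-∧ (r , a))))

  reach-cons : ∀ k {u w v} → T (adj u w) → T (reach Γ k w v) → T (reach Γ (suc k) u v)
  reach-cons zero {u} a r = subst (T ∘ reach Γ 1 u) (toWitness r) (reach-step 0 (fromWitness refl) a)
  reach-cons (suc k) {u} {w} {v} a r with to (T-∨ {reach Γ k w v}) r
  ... | inj₁ r′ = reach-suc (suc k) (reach-cons k a r′)
  ... | inj₂ s with any-elim _ s
  ...   | x , t with to (T-∧ {reach Γ k w x}) t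
  ...     | r′ , a′ = reach-step (suc k) (reach-cons k a r′) a′

  reach-sym : ∀ k {u v} → T (reach Γ k u v) → T (reach Γ k v u)
  reach-sym zero          r = fromWitness (sym (toWitness r))
  reach-sym (suc k) {u} {v} r with to (T-∨ {reach Γ k u v}) r
  ... | inj₁ r′ = reach-suc k (reach-sym k r′)
  ... | inj₂ s with any-elim _ s
  ...   | w , t with to (T-∧ {reach Γ k u w}) t
  ...     | r′ , a = reach-cons k (subst T (adj-sym w v) a) (reach-sym k r′)

  reach-comm : ∀ k u v → reach Γ k u v ≡ reach Γ k v u
  reach-comm k u v = T-ext (reach-sym k) (reach-sym k)

  dist-comm : ∀ i u v → dist Γ i u v ≡ dist Γ i v u
  dist-comm zero    u v = reach-comm 0 u v
  dist-comm (suc i) u v = cong₂ (λ a b → a ∧ not b) (reach-comm (suc i) u v) (reach-comm i u v)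

  reach⇒dist : ∀ d {u v} → T (reach Γ d u v) → ∃ λ k → k ≤ d × T (dist Γ k u v)
  reach⇒dist zero    r = 0 , z≤n , r
  reach⇒dist (suc d) {u} {v} r with T? (reach Γ d u v)
  ... | yes r′ with reach⇒dist d r′
  ...   | k , k≤d , δ = k , m≤n⇒m≤1+n k≤d , δ
  reach⇒dist (suc d) r | no ¬r′ = suc d , ≤-refl , from T-∧ (r , T-not ¬r′)

  distanceMatrix : ℕ → Matrix N N
  distanceMatrix i u v = 𝟙 (dist Γ i u v)

  distanceMatrix-symmetric : ∀ i → distanceMatrix i ᵀ ≐ distanceMatrix i
  distanceMatrix-symmetric i u v = cong 𝟙 (dist-comm i v u)

  distanceMatrix-square : ∀ {d p i} → DistanceRegular Γ d p → i ≤ d →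
                          ∀ u w → ∃ λ k → k ≤ d × (distanceMatrix i · distanceMatrix i) u w ≡ p i i k
  distanceMatrix-square {d} {p} {i} ((connected , _) , intersection) i≤d u w
    with reach⇒dist d (from T-≡ (connected u w))
  ... | k , k≤d , δ = k , k≤d , (begin
    (distanceMatrix i · distanceMatrix i) u w     ≡⟨ count-∧ (dist Γ i u) (λ z → dist Γ i z w) ⟨
    count (λ z → dist Γ i u z ∧ dist Γ i z w)     ≡⟨ intersection i i k i≤d i≤d k≤d u w (to T-≡ δ) ⟩
    p i i k                                       ∎)

corollary3p5 : (N : ℕ) (Γ : Graph N) (d : ℕ) (p : ℕ → ℕ → ℕ → ℕ)
    → DistanceRegular Γ d p
    → (m : ℕ) .{{_ : NonZero m}} → 2 ≤ m
    → (G : AutGroup Γ) (n : ℕ) (orb : Fin N → Fin n)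
    → IsOrbitPartition Γ G n orb
    → EqualOrbitLengths Γ n orb
    → (M : ℕ → Fin n → Fin n → ℕ)
    → (∀ i → 1 ≤ i → i ≤ d → IsQuotientMatrix Γ i n orb (M i))
    → (i : ℕ) → 1 ≤ i → i ≤ d
    → (∀ k → k ≤ d → m ∣ p i i k)
    → SelfOrthogonal m (InRowSpan m (M i))
corollary3p5 N Γ d p distanceRegular m _ G n orb (inhabited , _ , _) equalLengths M quotient i 1≤i i≤d m∣p =
  selfOrthogonal-rowSpan m (M i) m∣MMᵀ
  where
  open Distances Γ
  open Quotient orb

  A : Matrix N N
  A = distanceMatrix i

  qA : IsQuotientOf A (M i)
  qA u b = trans (quotient i 1≤i i≤d u b) (count-∧ (dist Γ i u) (λ z → eqF (orb z) b))

  equalSizes : ∀ a b → cellSize a ≡ cellSize b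
  equalSizes a b = trans (sym (∑≡sum (λ u → characteristic u a))) (trans (equalLengths a b) (∑≡sum (λ u → characteristic u b)))

  M-symmetric : M i ᵀ ≐ M i
  M-symmetric = quotient-symmetric inhabited equalSizes (distanceMatrix-symmetric i) qA

  m∣A² : m ∣ᴹ A · A
  m∣A² u w with distanceMatrix-square distanceRegular i≤d u w
  ... | k , k≤d , A²≡p = subst (m ∣_) (sym A²≡p) (m∣p k k≤d)

  m∣M² : m ∣ᴹ M i · M i
  m∣M² = quotient-∣ᴹ inhabited (quotient-· {A} {A} {M i} {M i} qA qA) m∣A²

  m∣MMᵀ : m ∣ᴹ M i · M i ᵀ
  m∣MMᵀ a b = subst (m ∣_) (sym (·-congʳ (M i) M-symmetric a b)) (m∣M² a b)
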